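{- Let $n\ge 0$. Define a map $\Phi:\mathcal{G}'_n\to\mathcal{G}_n$ as follows. For $w=w_1\dots w_{n+1}\in\mathcal{G}'_n$: if $w_{n+1}=0$, set $\Phi(w)=w_1\dots w_n$. Otherwise (then necessarily $w_{n+1}=-1$), let $j$ be the largest index in $\{1,\dots,n+1\}$ with $w_1+\dots+w_{j-1}=0$ (so $j\le n$ and $w_j=1$), i.e. write $w=w'\,1\,w''\,(-1)$ with $w'=w_1\dots w_{j-1}$ and $w''=w_{j+1}\dots w_n$, and set $\Phi(w)=w'\,\bar 0\,w''=w_1\dots w_{j-1}\,\bar 0\,w_{j+1}\dots w_n$. Then $\Phi$ is a well-defined bijection from $\mathcal{G}'_n$ onto $\mathcal{G}_n$.
   Context: Consider the four-letter alphabet $\{ -1,0,\bar 0,1\}$, where $\bar 0$ is a letter distinct from $0$ whose numerical value in sums is $0$. $\mathcal{G}_n$ is the set of words $w_1\dots w_n$ of length $n$ over $\{ -1,0,\bar 0,1\}$ with total sum $0$ and all partial sums $w_1+\dots+w_i$ non-negative. $\mathcal{G}'_n$ is the set of words $w_1\dots w_{n+1}$ of length $n+1$ over the same alphabet with total sum $0$, all partial sums non-negative, and such that whenever $w_i=\bar 0$ the partial sum $w_1+\dots+w_{i-1}$ is strictly positive. -}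

module Defs where

open import Data.Nat using (ℕ; zero; suc)
open import Data.Fin using (Fin; toℕ)
open import Data.Vec using (Vec; []; _∷_; lookup; init; last)
open import Data.Integer using (ℤ; +_; -[1+_]; _+_; _≤_; _<_)
import Data.Integer as ℤ
open import Data.Bool using (Bool; if_then_else_)
open import Relation.Nullary using (does)
open import Relation.Binary.PropositionalEquality using (_≡_)
open import Data.Product using (_×_)

-- The alphabet {-1, 0, 0̄, 1}.
data Letter : Set where
  m1 z zb p1 : Letter

val : Letter → ℤ
val m1 = -[1+ 0 ]
val z  = + 0
val zb = + 0
val p1 = + 1

psum : ∀ {n} → Vec Letter n → ℕ → ℤ
psum []       _       = + 0
psum (x ∷ xs) zero    = + 0
psum (x ∷ xs) (suc i) = val x + psum xs i

G : (n : ℕ) → Vec Letter n → Set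
G n w = (psum w n ≡ + 0) × (∀ (i : Fin (suc n)) → + 0 ≤ psum w (toℕ i))

-- 𝒢'_n : words of length n+1, total sum 0, partial sums non-negative,
-- and w_{i+1} = 0̄ (0-based position i) only if w_1+...+w_i > 0
G' : (n : ℕ) → Vec Letter (suc n) → Set
G' n w = G (suc n) w
       × (∀ (i : Fin (suc n)) → lookup w i ≡ zb → + 0 < psum w (toℕ i))

-- lastZeroFrom s i best v : scanning v whose letters start at 0-based position i
-- with running prefix sum s, returns the largest k ≥ i (k ≤ i + length v) such that
-- the prefix of length k has sum 0, or best if there is none.
lastZeroFrom : ∀ {m} → ℤ → ℕ → ℕ → Vec Letter m → ℕ
lastZeroFrom s i best []       = if does (s ℤ.≟ + 0) then i else best
lastZeroFrom s i best (x ∷ xs) =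
  lastZeroFrom (s + val x) (suc i) (if does (s ℤ.≟ + 0) then i else best) xs

-- largest k ∈ {0,…,n} with w_1+…+w_k = 0 (k = j-1 in the paper's notation)
lastZero : ∀ {n} → Vec Letter n → ℕ
lastZero v = lastZeroFrom (+ 0) 0 0 v

replaceBar : ∀ {n} → Vec Letter n → ℕ → Vec Letter n
replaceBar []       _       = []
replaceBar (x ∷ xs) zero    = zb ∷ xs
replaceBar (x ∷ xs) (suc k) = x ∷ replaceBar xs k

ΦAux : ∀ {n} → Letter → Vec Letter n → Vec Letter n
ΦAux z u = u
ΦAux _ u = replaceBar u (lastZero u)

Φ : ∀ {n} → Vec Letter (suc n) → Vec Letter n
Φ w = ΦAux (last w) (init w)

-- Read a word as a path with steps 1 up, −1 down and 0, 0̄ flat. A word of 𝒢′ₙ ends in 0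
-- after a path from height 0 to 0 in which every 0̄ is at positive height, or in −1 after
-- such a path from 0 to 1. In the latter case the letters after the last visit to height 0
-- are 1w″ with w″ staying at height ≥ 1, so replacing that 1 by 0̄ lowers w″ by one and
-- yields a word of 𝒢ₙ in which the new letter is the first 0̄ at height 0. The inverse Ψ
-- therefore looks for the first 0̄ at height 0: it turns it back into 1 and appends −1,
-- and if there is none it appends 0.
module Submission where

open import Defs
open import Data.Nat using (ℕ; suc; z≤n; s≤s)
import Data.Nat as ℕ
import Data.Nat.Properties as ℕₚ
open import Data.Fin using (Fin; toℕ)
import Data.Fin as Fin
open import Data.Vec using (Vec; []; _∷_; _∷ʳ_; lookup; initLast)
open import Data.Vec.Properties using (init-∷ʳ; last-∷ʳ)
open import Data.Integer using (ℤ; +_; -[1+_]; _+_; _≤_; _<_; +≤+; +<+)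
import Data.Integer as ℤ
open import Data.Integer.Properties
  using (+-assoc; +-identityˡ; +-identityʳ; i<j⇒i≤pred[j]; <⇒≤; ≤∧≢⇒<)
open import Data.Bool using (true; false; if_then_else_)
open import Data.Maybe using (Maybe; just; nothing; maybe′; _<∣>_)
import Data.Maybe as Maybe
open import Data.Product using (_×_; Σ; ∃; _,_)
open import Data.Unit using (⊤; tt)
open import Function using (_∘_)
open import Relation.Nullary using (does; yes; no)
open import Relation.Binary.PropositionalEquality using (_≡_; refl; sym; trans; cong; cong₂; subst)

private
  variable
    n k : ℕ
    a b c h : ℤ
    x : Letter
    u w xs : Vec Letter n

data Rule : Set where
  free strict : Rule

Legal : Rule → ℤ → Letter → Set
Legal strict h zb = + 0 < h
Legal _      _ _  = ⊤

data Walk (r : Rule) : ℤ → ℤ → Vec Letter n → Set where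
  stop : + 0 ≤ h → Walk r h h []
  step : + 0 ≤ h → Legal r h x → Walk r (h + val x) b xs → Walk r h b (x ∷ xs)

walk-start-nonneg : ∀ {r} → Walk r h b w → + 0 ≤ h
walk-start-nonneg (stop p)     = p
walk-start-nonneg (step p _ _) = p

walk-end-nonneg : ∀ {r} → Walk r h b w → + 0 ≤ b
walk-end-nonneg (stop p)     = p
walk-end-nonneg (step _ _ s) = walk-end-nonneg s

walk⇒free : ∀ {r} → Walk r h b w → Walk free h b w
walk⇒free (stop p)     = stop p
walk⇒free (step p _ s) = step p tt (walk⇒free s)

legal-above-zero : ∀ r → + 0 < h → ∀ x → Legal r h x
legal-above-zero free   _   _  = tt
legal-above-zero strict _   m1 = tt
legal-above-zero strict _   z  = tt
legal-above-zero strict pos zb = pos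
legal-above-zero strict _   p1 = tt

BarsHigh : Rule → ℤ → Vec Letter n → Set
BarsHigh free   h w = ⊤
BarsHigh strict h w = ∀ i → lookup w i ≡ zb → + 0 < h + psum w (toℕ i)

record Profile (r : Rule) (h b : ℤ) (w : Vec Letter n) : Set where
  field
    ends     : h + psum w n ≡ b
    nonneg   : ∀ (i : Fin (suc n)) → + 0 ≤ h + psum w (toℕ i)
    barsHigh : BarsHigh r h w

height-∷ : ∀ h x (xs : Vec Letter n) i → h + psum (x ∷ xs) (suc i) ≡ (h + val x) + psum xs i
height-∷ h x xs i = sym (+-assoc h (val x) (psum xs i))

module _ {r : Rule} where
  open Profile

  Profile-[] : Profile r h b [] → + 0 ≤ h × h ≡ b
  Profile-[] {h} P =
    subst (+ 0 ≤_) (+-identityʳ h) (nonneg P Fin.zero) , trans (sym (+-identityʳ h)) (ends P)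

  Profile-head : Profile r h b (x ∷ xs) → + 0 ≤ h × Legal r h x
  Profile-head {h} {x = x} P =
    subst (+ 0 ≤_) (+-identityʳ h) (nonneg P Fin.zero) , legal r x (barsHigh P)
    where
    legal : ∀ r x → BarsHigh r h (x ∷ xs) → Legal r h x
    legal free   _  _  = tt
    legal strict m1 _  = tt
    legal strict z  _  = tt
    legal strict zb bh = subst (+ 0 <_) (+-identityʳ h) (bh Fin.zero refl)
    legal strict p1 _  = tt

  Profile-tail : Profile r h b (x ∷ xs) → Profile r (h + val x) b xs
  Profile-tail {h} {x = x} {xs = xs} P = record
    { ends     = trans (sym (height-∷ h x xs _)) (ends P)
    ; nonneg   = λ i → subst (+ 0 ≤_) (height-∷ h x xs (toℕ i)) (nonneg P (Fin.suc i))
    ; barsHigh = bars r (barsHigh P)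
    }
    where
    bars : ∀ r → BarsHigh r h (x ∷ xs) → BarsHigh r (h + val x) xs
    bars free   _        = tt
    bars strict bh i e = subst (+ 0 <_) (height-∷ h x xs (toℕ i)) (bh (Fin.suc i) e)

  Profile-stop : + 0 ≤ h → Profile r h h []
  Profile-stop {h} p = record
    { ends     = +-identityʳ h
    ; nonneg   = λ { Fin.zero → subst (+ 0 ≤_) (sym (+-identityʳ h)) p }
    ; barsHigh = bars r
    }
    where
    bars : ∀ r → BarsHigh r h []
    bars free   = tt
    bars strict ()

  Profile-step : + 0 ≤ h → Legal r h x → Profile r (h + val x) b xs → Profile r h b (x ∷ xs)
  Profile-step {h} {x = x} {xs = xs} p ok P = record
    { ends     = trans (height-∷ h x xs _) (ends P)
    ; nonneg   = λ { Fin.zero    → subst (+ 0 ≤_) (sym (+-identityʳ h)) p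
                   ; (Fin.suc i) → subst (+ 0 ≤_) (sym (height-∷ h x xs (toℕ i))) (nonneg P i) }
    ; barsHigh = bars r ok (barsHigh P)
    }
    where
    bars : ∀ r → Legal r h x → BarsHigh r (h + val x) xs → BarsHigh r h (x ∷ xs)
    bars free   _  _  = tt
    bars strict ok _  Fin.zero    refl = subst (+ 0 <_) (sym (+-identityʳ h)) ok
    bars strict _  bh (Fin.suc i) e    = subst (+ 0 <_) (sym (height-∷ h x xs (toℕ i))) (bh i e)

  toWalk : Profile r h b w → Walk r h b w
  toWalk {w = []} P with Profile-[] P
  ... | p , refl = stop p
  toWalk {w = _ ∷ _} P with Profile-head P
  ... | p , ok = step p ok (toWalk (Profile-tail P))

  fromWalk : Walk r h b w → Profile r h b w
  fromWalk (stop p)      = Profile-stop p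
  fromWalk (step p ok s) = Profile-step p ok (fromWalk s)

G⇒walk : G n w → Walk free (+ 0) (+ 0) w
G⇒walk (sum , nonneg) = toWalk record
  { ends     = trans (+-identityˡ _) sum
  ; nonneg   = λ i → subst (+ 0 ≤_) (sym (+-identityˡ _)) (nonneg i)
  ; barsHigh = tt
  }

walk⇒G : Walk free (+ 0) (+ 0) w → G n w
walk⇒G s = trans (sym (+-identityˡ _)) ends , λ i → subst (+ 0 ≤_) (+-identityˡ _) (nonneg i)
  where open Profile (fromWalk s)

G'⇒walk : G' n w → Walk strict (+ 0) (+ 0) w
G'⇒walk ((sum , nonneg) , bars) = toWalk record
  { ends     = trans (+-identityˡ _) sum
  ; nonneg   = λ i → subst (+ 0 ≤_) (sym (+-identityˡ _)) (nonneg i)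
  ; barsHigh = λ i e → subst (+ 0 <_) (sym (+-identityˡ _)) (bars i e)
  }

walk⇒G' : Walk strict (+ 0) (+ 0) w → G' n w
walk⇒G' s = walk⇒G (walk⇒free s) , λ i e → subst (+ 0 <_) (+-identityˡ _) (barsHigh i e)
  where open Profile (fromWalk s)

walk-unsnoc : ∀ {r} (u : Vec Letter n) → Walk r h b (u ∷ʳ x) →
              ∃ λ c → Walk r h c u × Legal r c x × c + val x ≡ b
walk-unsnoc         []      (step p ok (stop _)) = _ , stop p , ok , refl
walk-unsnoc (_ ∷ u) (step p ok s) with walk-unsnoc u s
... | c , s′ , ok′ , e = c , step p ok s′ , ok′ , e

walk-∷ʳ : ∀ {r} → Walk r h c u → Legal r c x → + 0 ≤ c + val x →
          Walk r h (c + val x) (u ∷ʳ x)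
walk-∷ʳ (stop p)      ok q = step p ok (stop q)
walk-∷ʳ (step p ok s) ok′ q = step p ok (walk-∷ʳ s ok′ q)

data LastLetter : Vec Letter (suc n) → Set where
  endsWith-z  : Walk strict (+ 0) (+ 0) u → LastLetter (u ∷ʳ z)
  endsWith-m1 : Walk strict (+ 0) (+ 1) u → LastLetter (u ∷ʳ m1)

lastLetter : ∀ x → Walk strict (+ 0) c u → Legal strict c x → c + val x ≡ + 0 →
             LastLetter (u ∷ʳ x)
lastLetter {c} z s _ e =
  endsWith-z (subst (λ c → Walk strict (+ 0) c _) (trans (sym (+-identityʳ c)) e) s)
lastLetter {+ 1} m1 s _ _ = endsWith-m1 s
lastLetter {+ 0} m1 _ _ ()
lastLetter {+ suc (suc _)} m1 _ _ ()
lastLetter {+ 0} zb _ (+<+ ()) _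
lastLetter {+ suc _} zb _ _ ()
lastLetter {+ 0} p1 _ _ ()
lastLetter {+ suc _} p1 _ _ ()
lastLetter { -[1+ _ ]} x s _ _ with walk-end-nonneg s
... | ()

G'-lastLetter : G' n w → LastLetter w
G'-lastLetter {w = w} g with initLast w
... | u , x , refl with walk-unsnoc u (G'⇒walk g)
... | _ , s , ok , e = lastLetter x s ok e

atZero : ℤ → Maybe ℕ
atZero h = if does (h ℤ.≟ + 0) then just 0 else nothing

-- lastReturn h v is the largest k such that the first k letters of v, read from height h,
-- end at height 0.
lastReturn : ℤ → Vec Letter n → Maybe ℕ
lastReturn h []       = atZero h
lastReturn h (x ∷ xs) = Maybe.map suc (lastReturn (h + val x) xs) <∣> atZero h

atZero-if : ∀ h i best →
            (if does (h ℤ.≟ + 0) then i else best) ≡ maybe′ (i ℕ.+_) best (atZero h)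
atZero-if h i best with does (h ℤ.≟ + 0)
... | true  = sym (ℕₚ.+-identityʳ i)
... | false = refl

lastZeroFrom-lastReturn : ∀ h i best (v : Vec Letter n) →
                          lastZeroFrom h i best v ≡ maybe′ (i ℕ.+_) best (lastReturn h v)
lastZeroFrom-lastReturn h i best []       = atZero-if h i best
lastZeroFrom-lastReturn h i best (x ∷ xs) =
  trans (lastZeroFrom-lastReturn (h + val x) (suc i) _ xs) (shift (lastReturn (h + val x) xs))
  where
  shift : ∀ r → maybe′ (suc i ℕ.+_) (if does (h ℤ.≟ + 0) then i else best) r
              ≡ maybe′ (i ℕ.+_) best (Maybe.map suc r <∣> atZero h)
  shift (just k) = sym (ℕₚ.+-suc i k)
  shift nothing  = atZero-if h i best

lastZero-lastReturn : ∀ (u : Vec Letter n) → lastReturn (+ 0) u ≡ just k → lastZero u ≡ k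
lastZero-lastReturn u e = trans (lastZeroFrom-lastReturn (+ 0) 0 0 u) (cong (maybe′ (0 ℕ.+_) 0) e)

returns-from-origin : (v : Vec Letter n) → ∃ λ k → lastReturn (+ 0) v ≡ just k
returns-from-origin []       = 0 , refl
returns-from-origin (x ∷ xs) with lastReturn (+ 0 + val x) xs
... | just k  = suc k , refl
... | nothing = 0 , refl

no-return⇒positive : ∀ v → + 0 ≤ h → lastReturn {n} h v ≡ nothing → + 0 < h
no-return⇒positive {+ 0} v _ e with returns-from-origin v
... | _ , e′ with trans (sym e′) e
... | ()
no-return⇒positive {+ suc _} _ _ _ = +<+ (s≤s z≤n)

no-return-∷ : ∀ h x (xs : Vec Letter n) →
              lastReturn h (x ∷ xs) ≡ nothing → lastReturn (h + val x) xs ≡ nothing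
no-return-∷ h x xs e with lastReturn (h + val x) xs
... | nothing = refl

walk-lower : Walk strict a b xs → lastReturn a xs ≡ nothing →
             Walk free (ℤ.pred a) (ℤ.pred b) xs
walk-lower (stop p) e = stop (i<j⇒i≤pred[j] (no-return⇒positive [] p e))
walk-lower {a} (step {x = x} {xs = xs} p _ s) e =
  step (i<j⇒i≤pred[j] (no-return⇒positive (x ∷ xs) p e)) tt
       (subst (λ c → Walk free c _ xs) (sym (+-assoc -[1+ 0 ] a (val x)))
              (walk-lower s (no-return-∷ a x xs e)))

suc-positive : + 0 ≤ a → + 0 < ℤ.suc a
suc-positive {+ _} _ = +<+ (s≤s z≤n)

walk-raise : Walk free a b xs → Walk strict (ℤ.suc a) (ℤ.suc b) xs
walk-raise (stop p) = stop (<⇒≤ (suc-positive p))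
walk-raise {a} (step {x = x} {xs = xs} p _ s) =
  step (<⇒≤ (suc-positive p)) (legal-above-zero strict (suc-positive p) x)
       (subst (λ c → Walk strict c _ xs) (sym (+-assoc (+ 1) a (val x))) (walk-raise s))

raised-no-return : Walk free a b xs → lastReturn (ℤ.suc a) xs ≡ nothing
raised-no-return {+ _} (stop _) = refl
raised-no-return {+ n} (step {x = x} {xs = xs} _ _ s)
  rewrite +-assoc (+ 1) (+ n) (val x) | raised-no-return s = refl

atZero-just : ∀ h → atZero h ≡ just k → h ≡ + 0 × k ≡ 0
atZero-just h e with h ℤ.≟ + 0
atZero-just h refl | yes h≡0 = h≡0 , refl

step-after-last-return : ∀ x → Legal strict (+ 0) x → Walk strict (+ 0 + val x) b xs →
                         lastReturn (+ 0 + val x) xs ≡ nothing → x ≡ p1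
step-after-last-return p1 _ _ _ = refl
step-after-last-return zb (+<+ ()) _ _
step-after-last-return m1 _ s _ with walk-start-nonneg s
... | ()
step-after-last-return {xs = xs} z _ s e with no-return⇒positive xs (walk-start-nonneg s) e
... | +<+ ()

walk-replaceBar : Walk strict h (+ 1) u → lastReturn h u ≡ just k →
                  Walk free h (+ 0) (replaceBar u k)
walk-replaceBar (stop _) ()
walk-replaceBar {h} (step {x = x} {xs = xs} p ok s) e with lastReturn (h + val x) xs in eq
walk-replaceBar (step p _ s) refl | just _ = step p tt (walk-replaceBar s eq)
walk-replaceBar {h} (step {x = x} p ok s) e | nothing with atZero-just h e
... | refl , refl with step-after-last-return x ok s eq
... | refl = step p tt (walk-lower s eq)

Ψ : ℤ → Vec Letter n → Vec Letter (suc n)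
Ψ h []        = z ∷ []
Ψ h (m1 ∷ xs) = m1 ∷ Ψ (h + val m1) xs
Ψ h (z  ∷ xs) = z ∷ Ψ (h + val z) xs
Ψ h (p1 ∷ xs) = p1 ∷ Ψ (h + val p1) xs
Ψ h (zb ∷ xs) with h ℤ.≟ + 0
... | yes _ = (p1 ∷ xs) ∷ʳ m1
... | no  _ = zb ∷ Ψ (h + val zb) xs

Ψ-∷ : ∀ x → Legal strict h x → Ψ h (x ∷ xs) ≡ x ∷ Ψ (h + val x) xs
Ψ-∷ m1 _ = refl
Ψ-∷ z  _ = refl
Ψ-∷ p1 _ = refl
Ψ-∷ {h} zb pos with h ℤ.≟ + 0
Ψ-∷ zb (+<+ ()) | yes refl
... | no _ = refl

Ψ-strict : Walk strict h b u → Ψ h u ≡ u ∷ʳ z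
Ψ-strict (stop _)              = refl
Ψ-strict (step {x = x} _ ok s) = trans (Ψ-∷ x ok) (cong (x ∷_) (Ψ-strict s))

Ψ-replaceBar : Walk strict h (+ 1) u → lastReturn h u ≡ just k →
               Ψ h (replaceBar u k) ≡ u ∷ʳ m1
Ψ-replaceBar (stop _) ()
Ψ-replaceBar {h} (step {x = x} {xs = xs} p ok s) e with lastReturn (h + val x) xs in eq
Ψ-replaceBar (step {x = x} _ ok s) refl | just _ =
  trans (Ψ-∷ x ok) (cong (x ∷_) (Ψ-replaceBar s eq))
Ψ-replaceBar {h} (step {x = x} _ ok s) e | nothing with atZero-just h e
... | refl , refl with step-after-last-return x ok s eq
... | refl = refl

data Preimage (h : ℤ) (u : Vec Letter n) : Vec Letter (suc n) → Set where
  keep    : Walk strict h (+ 0) u → Preimage h u (u ∷ʳ z)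
  restore : ∀ {u′} k → Walk strict h (+ 1) u′ → lastReturn h u′ ≡ just k →
            replaceBar u′ k ≡ u → Preimage h u (u′ ∷ʳ m1)

Preimage-∷ : ∀ x {w} → + 0 ≤ h → Legal strict h x → Preimage (h + val x) xs w →
             Preimage h (x ∷ xs) (x ∷ w)
Preimage-∷ x p ok (keep s)            = keep (step p ok s)
Preimage-∷ x p ok (restore k s e eq) =
  restore (suc k) (step p ok s) (cong (λ r → Maybe.map suc r <∣> _) e) (cong (x ∷_) eq)

Ψ-preimage : Walk free h (+ 0) u → Preimage h u (Ψ h u)
Ψ-preimage (stop p)               = keep (stop p)
Ψ-preimage (step {x = m1} p _ s) = Preimage-∷ m1 p tt (Ψ-preimage s)
Ψ-preimage (step {x = z}  p _ s) = Preimage-∷ z  p tt (Ψ-preimage s)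
Ψ-preimage (step {x = p1} p _ s) = Preimage-∷ p1 p tt (Ψ-preimage s)
Ψ-preimage {h} (step {x = zb} {xs = xs} p _ s) with h ℤ.≟ + 0
... | yes refl = restore 0 (step p tt (walk-raise s)) returns refl
  where
  returns : lastReturn (+ 0) (p1 ∷ xs) ≡ just 0
  returns rewrite raised-no-return s = refl
... | no h≢0 = Preimage-∷ zb p (≤∧≢⇒< p (h≢0 ∘ sym)) (Ψ-preimage s)

Φ-∷ʳ : ∀ (u : Vec Letter n) x → Φ (u ∷ʳ x) ≡ ΦAux x u
Φ-∷ʳ u x = cong₂ ΦAux (last-∷ʳ x u) (init-∷ʳ x u)

Φ-∷ʳ-m1 : lastReturn (+ 0) u ≡ just k → Φ (u ∷ʳ m1) ≡ replaceBar u k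
Φ-∷ʳ-m1 {u = u} e = trans (Φ-∷ʳ u m1) (cong (replaceBar u) (lastZero-lastReturn u e))

Φ-G : LastLetter w → G n (Φ w)
Φ-G (endsWith-z {u = u} s)  = subst (G _) (sym (Φ-∷ʳ u z)) (walk⇒G (walk⇒free s))
Φ-G (endsWith-m1 {u = u} s) =
  let k , e = returns-from-origin u in subst (G _) (sym (Φ-∷ʳ-m1 e)) (walk⇒G (walk-replaceBar s e))

Ψ-Φ : LastLetter w → Ψ (+ 0) (Φ w) ≡ w
Ψ-Φ (endsWith-z {u = u} s)  = trans (cong (Ψ (+ 0)) (Φ-∷ʳ u z)) (Ψ-strict s)
Ψ-Φ (endsWith-m1 {u = u} s) =
  let k , e = returns-from-origin u in trans (cong (Ψ (+ 0)) (Φ-∷ʳ-m1 e)) (Ψ-replaceBar s e)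

Preimage-origin : Preimage (+ 0) u w → G' n w × Φ w ≡ u
Preimage-origin {u = u} (keep s)         = walk⇒G' (walk-∷ʳ s tt (+≤+ z≤n)) , Φ-∷ʳ u z
Preimage-origin (restore _ s e replaced) =
  walk⇒G' (walk-∷ʳ s tt (+≤+ z≤n)) , trans (Φ-∷ʳ-m1 e) replaced

mainTheorem2 : (n : ℕ) →
    ((w : Vec Letter (suc n)) → G' n w → G n (Φ w))
    × ((w v : Vec Letter (suc n)) → G' n w → G' n v → Φ w ≡ Φ v → w ≡ v)
    × ((u : Vec Letter n) → G n u → Σ (Vec Letter (suc n)) (λ w → G' n w × Φ w ≡ u))
mainTheorem2 n = Φ-into , Φ-injective , Φ-onto
  where
  Φ-into : (w : Vec Letter (suc n)) → G' n w → G n (Φ w)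
  Φ-into w g = Φ-G (G'-lastLetter g)

  Φ-injective : (w v : Vec Letter (suc n)) → G' n w → G' n v → Φ w ≡ Φ v → w ≡ v
  Φ-injective w v gw gv eq =
    trans (sym (Ψ-Φ (G'-lastLetter gw))) (trans (cong (Ψ (+ 0)) eq) (Ψ-Φ (G'-lastLetter gv)))

  Φ-onto : (u : Vec Letter n) → G n u → Σ (Vec Letter (suc n)) (λ w → G' n w × Φ w ≡ u)
  Φ-onto u g = Ψ (+ 0) u , Preimage-origin (Ψ-preimage (G⇒walk g))
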